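{- Let $L_R:=\{w\in\mathcal{D}^{\mathrm{sym}}:\mathrm{ct}(w)>0\}$ and $L_S:=\{w\in\mathcal{D}^{\mathrm{sym}}:\Omega(w)\text{ is odd}\}$. Then $L_R=L_S$.
   Context: The Dyck language $\mathcal{D}$ is the smallest language over $\{a,b\}$ with $\varepsilon\in\mathcal{D}$, $a\mathcal{D}b\subseteq\mathcal{D}$, $\mathcal{D}\mathcal{D}\subseteq\mathcal{D}$. The symmetric Dyck language is $\mathcal{D}^{\mathrm{sym}}=\{w\in\mathcal{D}:\widetilde{w}=\sigma(w)\}$, where $\widetilde{w}$ is the mirror image of $w$ and $\sigma$ is the monoid morphism with $a\mapsto b$, $b\mapsto a$. Irreducible Dyck words are those in $\mathcal{D}^{\mathrm{irr}}=a\mathcal{D}b$; every Dyck word is uniquely a concatenation of irreducible Dyck words, and $\Omega(w)$ is the number of irreducible factors of $w\in\mathcal{D}$. Central concatenation: let $\mathcal{S}=\{aa,ab,ba,bb\}$ and define the bijection $\varphi:\mathcal{S}^{\ast}\to\mathcal{S}^{\ast}$ (on words of even length) by $\varphi(\varepsilon)=\varepsilon$, $\varphi(xuy)=(xy)\varphi(u)$ for letters $x,y\in\{a,b\}$ and $u\in\mathcal{S}^{\ast}$; set $u\triangleleft v=\varphi^{ -1}(\varphi(u)\varphi(v))$. Then $(\mathcal{D},\triangleleft)$ is a monoid freely generated by $\mathcal{I}=\mathcal{D}_{\bullet}\setminus(\mathcal{D}_{\bullet}\triangleleft\mathcal{D}_{\bullet})$, where $\mathcal{D}_{\bullet}=\mathcal{D}\setminus\{\varepsilon\}$.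 The number of centered tunnels $\mathrm{ct}:(\mathcal{D},\triangleleft)\to(\mathbb{Z}_{\geq0},+)$ is the monoid morphism with $\mathrm{ct}(ab)=1$ and $\mathrm{ct}(w)=0$ for $w\in\mathcal{I}\setminus\{ab\}$. -}

module Defs where

open import Data.Nat using (ℕ; zero; suc; _+_; _*_)
open import Data.List using (List; []; _∷_; _++_; [_]; reverse; map; length)
open import Data.List.Relation.Unary.All using (All)
open import Data.Product using (Σ; ∃; _×_; _,_)
open import Relation.Binary.PropositionalEquality using (_≡_)
open import Relation.Nullary using (¬_)

data Letter : Set where
  a b : Letter

Word : Set
Word = List Letter

σ : Letter → Letter
σ a = b
σ b = a

data Dyck : Word → Set where
  dyck-ε   : Dyck []
  dyck-nest : ∀ {w} → Dyck w → Dyck (a ∷ w ++ [ b ])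
  dyck-cat  : ∀ {u v} → Dyck u → Dyck v → Dyck (u ++ v)

DyckSym : Word → Set
DyckSym w = Dyck w × (reverse w ≡ map σ w)

Irreducible : Word → Set
Irreducible w = Σ Word λ u → Dyck u × (w ≡ a ∷ u ++ [ b ])

concatW : List Word → Word
concatW [] = []
concatW (u ∷ us) = u ++ concatW us

-- fs is the (unique) factorization of w into irreducible Dyck words;
-- Ω(w) = length fs
IrrFactorization : Word → List Word → Set
IrrFactorization w fs = All Irreducible fs × (concatW fs ≡ w)

-- The bijection φ on even-length words, as its defining graph:
-- φ(ε) = ε,  φ(x u y) = (x y) φ(u)
data Φ : Word → Word → Set where
  φ-ε : Φ [] []
  φ-step : ∀ x y {u v} → Φ u v → Φ (x ∷ u ++ [ y ]) (x ∷ y ∷ v)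

-- Central concatenation as a relation: u ◁ v = w  iff  φ(w) = φ(u) φ(v)
CentralCat : Word → Word → Word → Set
CentralCat u v w = Σ Word λ pu → Σ Word λ pv →
  Φ u pu × Φ v pv × Φ w (pu ++ pv)

NonEmptyDyck : Word → Set
NonEmptyDyck w = Dyck w × ¬ (w ≡ [])

Generator : Word → Set
Generator w = NonEmptyDyck w ×
  ¬ (Σ Word λ u → Σ Word λ v → NonEmptyDyck u × NonEmptyDyck v × CentralCat u v w)

-- w = g₁ ◁ (g₂ ◁ (… ◁ gₖ)) (◁ is associative, with unit ε)
CentralFold : List Word → Word → Set
CentralFold [] w = w ≡ []
CentralFold (g ∷ gs) w = Σ Word λ r → CentralFold gs r × CentralCat g r w

CentralFactorization : Word → List Word → Set
CentralFactorization w gs = All Generator gs × CentralFold gs w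

isAB : Word → ℕ
isAB (a ∷ b ∷ []) = 1
isAB _ = 0

countAB : List Word → ℕ
countAB [] = 0
countAB (g ∷ gs) = isAB g + countAB gs

-- ct(w) for w with central factorization gs (ct is the monoid morphism
-- with ct(ab) = 1, ct(g) = 0 for other generators g)
ct-of : List Word → ℕ
ct-of = countAB

Odd : ℕ → Set
Odd n = ∃ λ k → n ≡ suc (2 * k)

-- Write w = L ++ mirror L and let k be the height of the Dyck path at its midpoint.
-- The returns to height 0 pair up across the midpoint, except the final one and
-- a return at the midpoint itself; hence Ω(w) is odd iff k > 0.  On the other hand
-- φ(w) = x₁ σx₁ x₂ σx₂ …, so central concatenation of symmetric words is
-- concatenation of their first halves, and midpoint heights add up.  A generator
-- other than ab has midpoint height 0, since otherwise cutting its first half just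
-- after the last rise to the midpoint height splits it centrally; so k = ct(w).
module Submission where

open import Defs
open import Data.Nat using (ℕ; zero; suc; _+_; _*_; _<_; z≤n; s≤s)
open import Data.Nat.Properties using (+-comm; +-identityʳ; even≢odd)
open import Data.Nat.Tactic.RingSolver using (solve-∀)
open import Data.List using (List; []; _∷_; _++_; [_]; length; reverse; map)
open import Data.List.Properties
  using (∷-injective; ∷ʳ-injective; ++-assoc; ++-identityʳ; ++-conicalˡ; map-++; unfold-reverse; reverse-++)
open import Data.List.Relation.Unary.All using (All; []; _∷_)
open import Data.Maybe using (Maybe; just; nothing)
open import Data.Maybe.Properties using (just-injective)
open import Data.Product using (_×_; ∃-syntax; _,_)
open import Data.Empty using (⊥-elim)
open import Relation.Nullary using (¬_)
open import Relation.Binary.PropositionalEquality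
  using (_≡_; refl; sym; trans; cong; cong₂; subst; module ≡-Reasoning)

open ≡-Reasoning

height : ℕ → Word → Maybe ℕ
height n [] = just n
height n (a ∷ w) = height (suc n) w
height zero (b ∷ w) = nothing
height (suc n) (b ∷ w) = height n w

-- Counts the steps from height 1 to height 0; the count stops (junk) once the
-- path has gone below 0.
returns : ℕ → Word → ℕ
returns n [] = 0
returns n (a ∷ w) = returns (suc n) w
returns zero (b ∷ w) = 0
returns (suc zero) (b ∷ w) = suc (returns 0 w)
returns (suc (suc n)) (b ∷ w) = returns (suc n) w

-- mirror w is σ(w̃); the symmetric words are exactly the L ++ mirror L.
mirror : Word → Word
mirror [] = []
mirror (x ∷ w) = mirror w ++ [ σ x ]

-- doubled L = φ (L ++ mirror L)
doubled : Word → Word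
doubled [] = []
doubled (x ∷ w) = x ∷ σ x ∷ doubled w

sgn : ℕ → ℕ
sgn zero = 0
sgn (suc _) = 1

DyckPrefix : Word → Set
DyckPrefix w = ∃[ k ] height 0 w ≡ just k

NonEmpty : Word → Set
NonEmpty w = ¬ (w ≡ [])

mirror-++ : ∀ u v → mirror (u ++ v) ≡ mirror v ++ mirror u
mirror-++ [] v = sym (++-identityʳ (mirror v))
mirror-++ (x ∷ u) v = begin
  mirror (u ++ v) ++ [ σ x ]        ≡⟨ cong (_++ [ σ x ]) (mirror-++ u v) ⟩
  (mirror v ++ mirror u) ++ [ σ x ] ≡⟨ ++-assoc (mirror v) (mirror u) [ σ x ] ⟩
  mirror v ++ mirror u ++ [ σ x ]   ∎

σ-involutive : ∀ x → σ (σ x) ≡ x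
σ-involutive a = refl
σ-involutive b = refl

mirror-involutive : ∀ w → mirror (mirror w) ≡ w
mirror-involutive [] = refl
mirror-involutive (x ∷ w) =
  trans (mirror-++ (mirror w) [ σ x ]) (cong₂ _∷_ (σ-involutive x) (mirror-involutive w))

doubled-++ : ∀ u v → doubled (u ++ v) ≡ doubled u ++ doubled v
doubled-++ [] v = refl
doubled-++ (x ∷ u) v = cong (λ t → x ∷ σ x ∷ t) (doubled-++ u v)

reverse-∷-∷ʳ : ∀ {A : Set} (x : A) u y → reverse (x ∷ u ++ [ y ]) ≡ y ∷ reverse u ++ [ x ]
reverse-∷-∷ʳ x u y = trans (unfold-reverse x (u ++ [ y ])) (cong (_++ [ x ]) (reverse-++ u [ y ]))

height-++ : ∀ n u v {m} → height n u ≡ just m → height n (u ++ v) ≡ height m v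
height-++ n [] v eq rewrite just-injective eq = refl
height-++ n (a ∷ u) v eq = height-++ (suc n) u v eq
height-++ (suc n) (b ∷ u) v eq = height-++ n u v eq

height-++-nothing : ∀ n u v → height n u ≡ nothing → height n (u ++ v) ≡ nothing
height-++-nothing n (a ∷ u) v eq = height-++-nothing (suc n) u v eq
height-++-nothing zero (b ∷ u) v eq = refl
height-++-nothing (suc n) (b ∷ u) v eq = height-++-nothing n u v eq

height-++⁻ˡ : ∀ n u v {m} → height n (u ++ v) ≡ just m → ∃[ k ] height n u ≡ just k
height-++⁻ˡ n u v eq with height n u in e
... | just k = k , refl
... | nothing with () ← trans (sym (height-++-nothing n u v e)) eq

height-+ : ∀ n u c {m} → height n u ≡ just m → height (n + c) u ≡ just (m + c)
height-+ n [] c eq rewrite just-injective eq = refl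
height-+ n (a ∷ u) c eq = height-+ (suc n) u c eq
height-+ (suc n) (b ∷ u) c eq = height-+ n u c eq

height-mirror : ∀ n u {m} → height n u ≡ just m → height m (mirror u) ≡ just n
height-mirror n [] eq rewrite just-injective eq = refl
height-mirror n (a ∷ u) {m} eq = height-++ m (mirror u) [ b ] (height-mirror (suc n) u eq)
height-mirror (suc n) (b ∷ u) {m} eq = height-++ m (mirror u) [ a ] (height-mirror n u eq)

Dyck⇒height : ∀ {w} → Dyck w → ∀ n → height n w ≡ just n
Dyck⇒height dyck-ε n = refl
Dyck⇒height (dyck-nest {w} d) n = height-++ (suc n) w [ b ] (Dyck⇒height d (suc n))
Dyck⇒height (dyck-cat {u} {v} d e) n = trans (height-++ n u v (Dyck⇒height d n)) (Dyck⇒height e n)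

data Descent : ℕ → Word → Set where
  level : ∀ {w} → Dyck w → Descent 0 w
  step  : ∀ {n u v} → Dyck u → Descent n v → Descent (suc n) (u ++ b ∷ v)

Descent-prepend : ∀ {n u v} → Dyck u → Descent n v → Descent n (u ++ v)
Descent-prepend du (level dv) = level (dyck-cat du dv)
Descent-prepend {u = u} du (step {u = u′} {v = v} du′ dv) =
  subst (Descent _) (++-assoc u u′ (b ∷ v)) (step (dyck-cat du du′) dv)

height⇒Descent : ∀ n w → height n w ≡ just 0 → Descent n w
height⇒Descent n [] eq rewrite just-injective eq = level dyck-ε
height⇒Descent n (a ∷ w) eq with height⇒Descent (suc n) w eq
... | step {u = u} {v = v} du dv =
  subst (Descent n) (++-assoc (a ∷ u) [ b ] v) (Descent-prepend (dyck-nest du) dv)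
height⇒Descent (suc n) (b ∷ w) eq = step dyck-ε (height⇒Descent n w eq)

Descent⇒height : ∀ {n w} → Descent n w → height n w ≡ just 0
Descent⇒height (level d) = Dyck⇒height d 0
Descent⇒height {suc n} (step {u = u} {v = v} du dv) =
  trans (height-++ (suc n) u (b ∷ v) (Dyck⇒height du (suc n))) (Descent⇒height dv)

height⇒Dyck : ∀ w → height 0 w ≡ just 0 → Dyck w
height⇒Dyck w eq with height⇒Descent 0 w eq
... | level d = d

DyckPrefix⇒Dyck : ∀ u → DyckPrefix u → Dyck (u ++ mirror u)
DyckPrefix⇒Dyck u (k , eq) = height⇒Dyck _ (trans (height-++ 0 u (mirror u) eq) (height-mirror 0 u eq))

returns-++ : ∀ n u v {m} → height n u ≡ just m → returns n (u ++ v) ≡ returns n u + returns m v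
returns-++ n [] v eq rewrite just-injective eq = refl
returns-++ n (a ∷ u) v eq = returns-++ (suc n) u v eq
returns-++ (suc zero) (b ∷ u) v eq = cong suc (returns-++ 0 u v eq)
returns-++ (suc (suc n)) (b ∷ u) v eq = returns-++ (suc n) u v eq

returns-Dyck : ∀ {w} → Dyck w → ∀ n → returns (suc n) w ≡ 0
returns-Dyck dyck-ε n = refl
returns-Dyck (dyck-nest {w} d) n = begin
  returns (suc (suc n)) (w ++ [ b ])                    ≡⟨ returns-++ (suc (suc n)) w [ b ] (Dyck⇒height d _) ⟩
  returns (suc (suc n)) w + returns (suc (suc n)) [ b ] ≡⟨ cong (_+ 0) (returns-Dyck d (suc n)) ⟩
  0                                                     ∎
returns-Dyck (dyck-cat {u} {v} d e) n =
  trans (returns-++ (suc n) u v (Dyck⇒height d _)) (cong₂ _+_ (returns-Dyck d n) (returns-Dyck e n))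

returns-Irreducible : ∀ {w} → Irreducible w → returns 0 w ≡ 1
returns-Irreducible (u , du , refl) =
  trans (returns-++ 1 u [ b ] (Dyck⇒height du 1)) (cong (_+ 1) (returns-Dyck du 0))

returns-factorization : ∀ fs → All Irreducible fs → returns 0 (concatW fs) ≡ length fs
returns-factorization [] [] = refl
returns-factorization (f ∷ fs) (i@(_ , du , refl) ∷ is) =
  trans (returns-++ 0 f (concatW fs) (Dyck⇒height (dyck-nest du) 0))
        (cong₂ _+_ (returns-Irreducible i) (returns-factorization fs is))

returns-step-down : ∀ n → returns (suc n) [ b ] + sgn n ≡ 1
returns-step-down zero = refl
returns-step-down (suc n) = refl

-- The returns of u ++ mirror u pair up, up to the boundary terms sgn n and sgn m.
returns-mirror-parity : ∀ n u {m} → height n u ≡ just m →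
  ∃[ j ] returns n u + returns m (mirror u) + sgn n ≡ 2 * j + sgn m
returns-mirror-parity n [] eq rewrite just-injective eq = 0 , refl
returns-mirror-parity n (a ∷ u) {m} eq with returns-mirror-parity (suc n) u eq
... | j , ih = j , (begin
  R + returns m (mirror u ++ [ b ]) + sgn n  ≡⟨ cong (λ t → R + t + sgn n) (returns-++ m (mirror u) [ b ] (height-mirror (suc n) u eq)) ⟩
  R + (Z + returns (suc n) [ b ]) + sgn n    ≡⟨ regroup R Z _ (sgn n) ⟩
  R + Z + (returns (suc n) [ b ] + sgn n)    ≡⟨ cong (R + Z +_) (returns-step-down n) ⟩
  R + Z + 1                                  ≡⟨ ih ⟩
  2 * j + sgn m                              ∎)
  where
  R = returns (suc n) u
  Z = returns m (mirror u)
  regroup : ∀ x y z t → x + (y + z) + t ≡ x + y + (z + t)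
  regroup = solve-∀
returns-mirror-parity (suc zero) (b ∷ u) {m} eq with returns-mirror-parity zero u eq
... | j , ih = suc j , (begin
  suc R + returns m (mirror u ++ [ a ]) + 1  ≡⟨ cong (λ t → suc R + t + 1) (returns-++ m (mirror u) [ a ] (height-mirror 0 u eq)) ⟩
  suc R + (Z + 0) + 1                        ≡⟨ lift R Z ⟩
  2 + (R + Z + 0)                            ≡⟨ cong (2 +_) ih ⟩
  2 + (2 * j + sgn m)                        ≡⟨ double-suc j (sgn m) ⟩
  2 * suc j + sgn m                          ∎)
  where
  R = returns 0 u
  Z = returns m (mirror u)
  lift : ∀ x y → suc x + (y + 0) + 1 ≡ 2 + (x + y + 0)
  lift = solve-∀
  double-suc : ∀ x y → 2 + (2 * x + y) ≡ 2 * suc x + y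
  double-suc = solve-∀
returns-mirror-parity (suc (suc n)) (b ∷ u) {m} eq with returns-mirror-parity (suc n) u eq
... | j , ih = j , (begin
  R + returns m (mirror u ++ [ a ]) + 1  ≡⟨ cong (λ t → R + t + 1) (returns-++ m (mirror u) [ a ] (height-mirror (suc n) u eq)) ⟩
  R + (Z + 0) + 1                        ≡⟨ cong (λ t → R + t + 1) (+-identityʳ Z) ⟩
  R + Z + 1                              ≡⟨ ih ⟩
  2 * j + sgn m                          ∎)
  where
  R = returns (suc n) u
  Z = returns m (mirror u)

Odd-2*j+sgn : ∀ {n} j c → n ≡ 2 * j + sgn c → (0 < c → Odd n) × (Odd n → 0 < c)
Odd-2*j+sgn j zero eq = (λ ()) , λ (k , odd) →
  ⊥-elim (even≢odd j k (trans (sym (+-identityʳ (2 * j))) (trans (sym eq) odd)))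
Odd-2*j+sgn j (suc c) eq = (λ _ → j , trans eq (+-comm (2 * j) 1)) , λ _ → s≤s z≤n

Φ-functional : ∀ {u u′ p q} → Φ u p → Φ u′ q → u ≡ u′ → p ≡ q
Φ-functional φ-ε φ-ε _ = refl
Φ-functional φ-ε (φ-step _ _ _) ()
Φ-functional (φ-step _ _ _) φ-ε ()
Φ-functional (φ-step x _ {u} p) (φ-step _ _ {u′} q) e with refl , e′ ← ∷-injective e
  with eu , refl ← ∷ʳ-injective u u′ e′ = cong (λ t → x ∷ _ ∷ t) (Φ-functional p q eu)

Φ-injective : ∀ {u u′ p} → Φ u p → Φ u′ p → u ≡ u′
Φ-injective φ-ε φ-ε = refl
Φ-injective (φ-step x y p) (φ-step _ _ q) = cong (λ t → x ∷ t ++ [ y ]) (Φ-injective p q)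

Φ-doubled : ∀ u → Φ (u ++ mirror u) (doubled u)
Φ-doubled [] = φ-ε
Φ-doubled (x ∷ u) =
  subst (λ t → Φ (x ∷ t) (doubled (x ∷ u))) (++-assoc u (mirror u) [ σ x ]) (φ-step x (σ x) (Φ-doubled u))

Φ-doubled-split : ∀ {w p} → Φ w p → ∀ u q → doubled u ≡ p ++ q →
  ∃[ u₁ ] ∃[ u₂ ] (u ≡ u₁ ++ u₂) × (p ≡ doubled u₁) × (q ≡ doubled u₂)
Φ-doubled-split φ-ε u q e = [] , u , refl , refl , sym e
Φ-doubled-split (φ-step x y p) (z ∷ u) q e with refl , e′ ← ∷-injective e
  with refl , e″ ← ∷-injective e′
  with u₁ , u₂ , refl , refl , refl ← Φ-doubled-split p u q e″ = x ∷ u₁ , u₂ , refl , refl , refl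

symmetric-∷-∷ʳ⁻¹ : ∀ x u y → reverse (x ∷ u ++ [ y ]) ≡ map σ (x ∷ u ++ [ y ]) →
  (y ≡ σ x) × (reverse u ≡ map σ u)
symmetric-∷-∷ʳ⁻¹ x u y sym-xuy
  with e₁ , e₂ ← ∷-injective (trans (sym (reverse-∷-∷ʳ x u y)) (trans sym-xuy (cong (σ x ∷_) (map-++ σ u [ y ]))))
  with e₃ , _ ← ∷ʳ-injective (reverse u) (map σ u) e₂ = e₁ , e₃

Φ-symmetric : ∀ {w p} → Φ w p → reverse w ≡ map σ w →
  ∃[ u ] (p ≡ doubled u) × (w ≡ u ++ mirror u)
Φ-symmetric φ-ε _ = [] , refl , refl
Φ-symmetric (φ-step x y {u} p) sym-w
  with refl , sym-u ← symmetric-∷-∷ʳ⁻¹ x u y sym-w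
  with v , refl , refl ← Φ-symmetric p sym-u = x ∷ v , refl , cong (x ∷_) (++-assoc v (mirror v) [ σ x ])

CentralFold⇒Φ : ∀ {gs w} → CentralFold gs w → ∃[ p ] Φ w p
CentralFold⇒Φ {[]} refl = [] , φ-ε
CentralFold⇒Φ {_ ∷ _} (_ , _ , p , q , _ , _ , Φw) = p ++ q , Φw

Descent-suc⁻¹ : ∀ {n w} → Descent (suc n) w → ∃[ u ] ∃[ v ] (w ≡ u ++ b ∷ v) × Dyck u × Descent n v
Descent-suc⁻¹ (step {u = u} {v = v} du dv) = u , v , refl , du , dv

-- Read backwards (through mirror), u descends from its final height k + 1.
split-at-last-rise : ∀ u {k} → height 0 u ≡ just (suc k) →
  ∃[ u₁ ] ∃[ u₂ ] (u ≡ u₁ ++ a ∷ u₂) × (height 0 u₁ ≡ just k) × (height 0 u₂ ≡ just 0)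
split-at-last-rise u {k} eq
  with v₂ , v₁ , e , dv₂ , dv₁ ← Descent-suc⁻¹ (height⇒Descent (suc k) (mirror u) (height-mirror 0 u eq)) =
  mirror v₁ , mirror v₂ , u≡ , height-mirror k v₁ (Descent⇒height dv₁) , height-mirror 0 v₂ (Dyck⇒height dv₂ 0)
  where
  u≡ : u ≡ mirror v₁ ++ a ∷ mirror v₂
  u≡ = begin
    u                                  ≡⟨ sym (mirror-involutive u) ⟩
    mirror (mirror u)                  ≡⟨ cong mirror e ⟩
    mirror (v₂ ++ b ∷ v₁)              ≡⟨ mirror-++ v₂ (b ∷ v₁) ⟩
    (mirror v₁ ++ [ a ]) ++ mirror v₂  ≡⟨ ++-assoc (mirror v₁) [ a ] (mirror v₂) ⟩
    mirror v₁ ++ a ∷ mirror v₂         ∎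

++-∷-nonEmpty : ∀ u x v → NonEmpty (u ++ x ∷ v)
++-∷-nonEmpty [] x v ()
++-∷-nonEmpty (_ ∷ _) x v ()

DyckPrefix-split : ∀ x y u {k} → height 0 (x ∷ y ∷ u) ≡ just (suc k) →
  ∃[ u₁ ] ∃[ u₂ ] (x ∷ y ∷ u ≡ u₁ ++ u₂) ×
    NonEmpty u₁ × NonEmpty u₂ × DyckPrefix u₁ × DyckPrefix u₂
DyckPrefix-split x y u {k} eq with split-at-last-rise (x ∷ y ∷ u) eq
... | u₁ , c ∷ u₂ , e , h₁ , h₂ =
  u₁ ++ [ a ] , c ∷ u₂ , trans e (sym (++-assoc u₁ [ a ] (c ∷ u₂))) ,
  ++-∷-nonEmpty u₁ a [] , (λ ()) , (suc k , height-++ 0 u₁ [ a ] h₁) , (0 , h₂)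
... | z ∷ u₁ , [] , e , h₁ , _ = z ∷ u₁ , [ a ] , e , (λ ()) , (λ ()) , (k , h₁) , (1 , refl)
... | [] , [] , e , _ , _ with () ← ∷-injective e

CentralCat-halves : ∀ u₁ u₂ →
  CentralCat (u₁ ++ mirror u₁) (u₂ ++ mirror u₂) ((u₁ ++ u₂) ++ mirror (u₁ ++ u₂))
CentralCat-halves u₁ u₂ = doubled u₁ , doubled u₂ , Φ-doubled u₁ , Φ-doubled u₂ ,
  subst (Φ _) (doubled-++ u₁ u₂) (Φ-doubled (u₁ ++ u₂))

DyckPrefix⇒NonEmptyDyck : ∀ {u} → NonEmpty u → DyckPrefix u → NonEmptyDyck (u ++ mirror u)
DyckPrefix⇒NonEmptyDyck {u} u≢[] p = DyckPrefix⇒Dyck u p , λ e → u≢[] (++-conicalˡ u _ e)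

isAB-long : ∀ x y z w → isAB (x ∷ y ∷ z ∷ w) ≡ 0
isAB-long a a z w = refl
isAB-long a b z w = refl
isAB-long b a z w = refl
isAB-long b b z w = refl

isAB-long-symmetric : ∀ x y u → isAB ((x ∷ y ∷ u) ++ mirror (x ∷ y ∷ u)) ≡ 0
isAB-long-symmetric x y [] = isAB-long x y (σ y) [ σ x ]
isAB-long-symmetric x y (z ∷ u) = isAB-long x y z _

-- A generator whose first half ends above 0 splits centrally at the last rise to that height.
generator-midheight : ∀ u → Generator (u ++ mirror u) → height 0 u ≡ just (isAB (u ++ mirror u))
generator-midheight [] ((_ , ε≢[]) , _) = ⊥-elim (ε≢[] refl)
generator-midheight (a ∷ []) _ = refl
generator-midheight (b ∷ []) ((dg , _) , _) with () ← Dyck⇒height dg 0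
generator-midheight (x ∷ y ∷ u) ((dg , _) , indecomposable)
  rewrite isAB-long-symmetric x y u
  with height-++⁻ˡ 0 (x ∷ y ∷ u) _ (Dyck⇒height dg 0)
... | zero , h = h
... | suc k , h with u₁ , u₂ , e , ne₁ , ne₂ , p₁ , p₂ ← DyckPrefix-split x y u h =
  ⊥-elim (indecomposable (_ , _ , DyckPrefix⇒NonEmptyDyck ne₁ p₁ , DyckPrefix⇒NonEmptyDyck ne₂ p₂ ,
    subst (λ t → CentralCat _ _ (t ++ mirror t)) (sym e) (CentralCat-halves u₁ u₂)))

midheight-CentralFold : ∀ {gs w} u → CentralFold gs w → All Generator gs → Φ w (doubled u) →
  height 0 u ≡ just (countAB gs)
midheight-CentralFold {[]} [] refl [] _ = refl
midheight-CentralFold {[]} (_ ∷ _) refl [] ()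
midheight-CentralFold {g ∷ gs} u (r , fold , p , q , Φg , Φr , Φw) (gen ∷ gens) Φu
  with u₁ , u₂ , refl , refl , refl ← Φ-doubled-split Φg u q (Φ-functional Φu Φw refl)
  with refl ← Φ-injective Φg (Φ-doubled u₁)
  with refl ← Φ-injective Φr (Φ-doubled u₂) = begin
    height 0 (u₁ ++ u₂)        ≡⟨ height-++ 0 u₁ u₂ (generator-midheight u₁ gen) ⟩
    height (isAB g) u₂         ≡⟨ height-+ 0 u₂ (isAB g) (midheight-CentralFold u₂ fold gens Φr) ⟩
    just (countAB gs + isAB g) ≡⟨ cong just (+-comm (countAB gs) (isAB g)) ⟩
    just (isAB g + countAB gs) ∎

lemma16 : (w : Word) → DyckSym w →
    (fs : List Word) → IrrFactorization w fs →
    (gs : List Word) → CentralFactorization w gs →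
    ((0 < ct-of gs → Odd (length fs)) × (Odd (length fs) → 0 < ct-of gs))
lemma16 w (_ , symmetric) fs (irreducibles , concat-fs) gs (generators , fold)
  with _ , Φw ← CentralFold⇒Φ fold
  with u , refl , refl ← Φ-symmetric Φw symmetric
  with midheight ← midheight-CentralFold u fold generators Φw
  with j , parity ← returns-mirror-parity 0 u midheight =
  Odd-2*j+sgn j (countAB gs) (begin
    length fs                                             ≡⟨ sym (returns-factorization fs irreducibles) ⟩
    returns 0 (concatW fs)                                ≡⟨ cong (returns 0) concat-fs ⟩
    returns 0 (u ++ mirror u)                             ≡⟨ returns-++ 0 u (mirror u) midheight ⟩
    returns 0 u + returns (countAB gs) (mirror u)         ≡⟨ sym (+-identityʳ _) ⟩
    returns 0 u + returns (countAB gs) (mirror u) + 0     ≡⟨ parity ⟩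
    2 * j + sgn (countAB gs)                              ∎)
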